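{- Let $n\ge 7$. Then $src^\ell(W_n)=\chi_\ell(\overline{C_n^2})$.
   Context: The wheel $W_n$ is obtained from the cycle $C_n$ by adding a new vertex adjacent to all vertices of the cycle. $C_n^2$ is the square of the cycle $C_n$ (add to $C_n$ all edges between vertices at distance $2$ in $C_n$), and $\overline{C_n^2}$ is its complement. $\chi_\ell(H)$ denotes the list chromatic number (choice number) of a graph $H$: the least $r$ such that for every assignment of lists of at least $r$ colours to the vertices there is a proper vertex colouring choosing each vertex's colour from its list. An edge-coloured path is rainbow if all its edges have distinct colours; a geodesic is a shortest path between its endpoints. An (not necessarily proper) edge-colouring of a connected graph is strongly rainbow connected if any two vertices are joined by a rainbow geodesic. An $r$-edge-list assignment of $G$ assigns to each edge $e$ a set $L(e)\subset\mathbb N$ with $|L(e)|\ge r$; an $L$-edge-colouring is an edge-colouring $c$ with $c(e)\in L(e)$ for all $e$. $src^\ell(G)$ is the minimum integer $r$ such that for every $r$-edge-list assignment $L$ of $G$ there exists a strongly rainbow connected $L$-edge-colouring of $G$. -}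

module Defs where

open import Data.Nat using (ℕ; zero; suc; _+_; _≤_; _<_)
open import Data.Fin using (Fin; toℕ; fromℕ; inject₁)
open import Data.List using (List; length)
open import Data.List.Membership.Propositional using (_∈_)
open import Data.List.Relation.Unary.Unique.Propositional using (Unique)
open import Data.Product using (Σ; ∃; _×_; _,_)
open import Data.Sum using (_⊎_)
open import Relation.Nullary using (¬_)
open import Relation.Binary.PropositionalEquality using (_≡_; _≢_)

-- j is obtained from i by moving k steps forward around C_n
-- (i.e. toℕ j ≡ toℕ i + k  (mod n), for small k)
Fwd : ∀ {n} → ℕ → Fin n → Fin n → Set
Fwd {n} k i j = (toℕ j ≡ toℕ i + k) ⊎ (toℕ j + n ≡ toℕ i + k)

CycleAdj : ∀ {n} → Fin n → Fin n → Set
CycleAdj i j = Fwd 1 i j ⊎ Fwd 1 j i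

CycleSqAdj : ∀ {n} → Fin n → Fin n → Set
CycleSqAdj i j = CycleAdj i j ⊎ (Fwd 2 i j ⊎ Fwd 2 j i)

CoCycleSqAdj : ∀ {n} → Fin n → Fin n → Set
CoCycleSqAdj i j = (i ≢ j) × ¬ CycleSqAdj i j

IsListAssignment : {V : Set} → ℕ → (V → List ℕ) → Set
IsListAssignment {V} r L = (∀ v → Unique (L v)) × (∀ v → r ≤ length (L v))

ListColourable : (V : Set) → (V → V → Set) → ℕ → Set
ListColourable V Adj r =
  (L : V → List ℕ) → IsListAssignment r L →
  Σ (V → ℕ) λ c → (∀ v → c v ∈ L v) × (∀ u v → Adj u v → c u ≢ c v)

IsListChromaticNumber : (V : Set) → (V → V → Set) → ℕ → Set
IsListChromaticNumber V Adj k =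
  ListColourable V Adj k × (∀ r → r < k → ¬ ListColourable V Adj r)

record EGraph : Set₁ where
  field
    V     : Set
    E     : Set
    Joins : E → V → V → Set

module _ (G : EGraph) where
  open EGraph G

  record Walk (u v : V) (k : ℕ) : Set where
    field
      verts : Fin (suc k) → V
      edges : Fin k → E
      start : verts Fin.zero ≡ u
      end   : verts (fromℕ k) ≡ v
      step  : ∀ i → Joins (edges i) (verts (inject₁ i)) (verts (Fin.suc i))

  IsGeodesic : ∀ {u v k} → Walk u v k → Set
  IsGeodesic {u} {v} {k} _ = ∀ k' → Walk u v k' → k ≤ k'

  IsRainbow : ∀ {u v k} → (E → ℕ) → Walk u v k → Set
  IsRainbow {k = k} c w = ∀ (i j : Fin k) → c (Walk.edges w i) ≡ c (Walk.edges w j) → i ≡ j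

  StronglyRainbowConnected : (E → ℕ) → Set
  StronglyRainbowConnected c =
    ∀ u v → ∃ λ k → Σ (Walk u v k) λ w → IsGeodesic w × IsRainbow c w

  IsEdgeListAssignment : ℕ → (E → List ℕ) → Set
  IsEdgeListAssignment r L = (∀ e → Unique (L e)) × (∀ e → r ≤ length (L e))

  SRCListColourable : ℕ → Set
  SRCListColourable r =
    (L : E → List ℕ) → IsEdgeListAssignment r L →
    Σ (E → ℕ) λ c → (∀ e → c e ∈ L e) × StronglyRainbowConnected c

  IsSrcList : ℕ → Set
  IsSrcList k = SRCListColourable k × (∀ r → r < k → ¬ SRCListColourable r)

data WVertex (n : ℕ) : Set where
  hub : WVertex n
  rim : Fin n → WVertex n

data WEdge (n : ℕ) : Set where
  spoke  : Fin n → WEdge n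
  rimEdge : Fin n → WEdge n

data WJoins (n : ℕ) : WEdge n → WVertex n → WVertex n → Set where
  spoke-out : ∀ i → WJoins n (spoke i) hub (rim i)
  spoke-in  : ∀ i → WJoins n (spoke i) (rim i) hub
  rim-fwd   : ∀ i j → Fwd 1 i j → WJoins n (rimEdge i) (rim i) (rim j)
  rim-bwd   : ∀ i j → Fwd 1 i j → WJoins n (rimEdge i) (rim j) (rim i)

Wheel : ℕ → EGraph
Wheel n = record { V = WVertex n ; E = WEdge n ; Joins = WJoins n }

module Submission where

-- If rim vertices a and b are at distance at least 3 on C_n, the only geodesics between them in
-- W_n run through the hub along the spokes at a and b.  So in a strongly rainbow connected
-- colouring those two spokes differ, and the spoke colours form a list colouring of the
-- complement of C_n²: src^ℓ(W_n) ≥ χ_ℓ.  Conversely, from lists of size r ≥ 3 colour the spokes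
-- properly for that complement and the rim so that consecutive rim edges differ; rim vertices
-- at distance 2 are then joined by a rainbow rim path, farther ones by a rainbow path through
-- the hub.  For n ≥ 7 the complement of C_n² contains a 7-cycle, so χ_ℓ ≥ 3 and both numbers
-- agree.  The least r exists constructively because list colourability of a finite graph is
-- decidable: an r-list assignment matters only through which of its entries coincide.

open import Defs
open import Data.Nat using (ℕ; _≤_)
open import Data.Fin using (Fin)
open import Data.Product using (∃; _×_)

open import Data.Empty using (⊥-elim)
open import Data.Fin as Fin using (toℕ; fromℕ<; inject₁; inject≤; combine; remQuot; finToFun; funToFin; #_)
open import Data.Fin.Properties as Finₚ using (any?; all?; ¬∀⟶∃¬; pigeonhole; finToFun-funToFin)
open import Data.List using (List; []; _∷_; length; lookup; tabulate)
open import Data.List.Properties using (length-tabulate)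
open import Data.List.Membership.Propositional using (_∈_; _∉_)
open import Data.List.Membership.Propositional.Properties using (∈-lookup; ∈-tabulate⁺; ∈-tabulate⁻)
open import Data.List.Relation.Binary.Subset.Propositional using (_⊆_)
open import Data.List.Relation.Unary.All as All using ()
open import Data.List.Relation.Unary.AllPairs using ([]; _∷_)
open import Data.List.Relation.Unary.Any as Any using (here; there)
open import Data.List.Relation.Unary.Any.Properties using (lookup-index)
open import Data.List.Relation.Unary.Unique.Propositional using (Unique)
open import Data.List.Relation.Unary.Unique.Propositional.Properties using (tabulate⁺)
open import Data.Nat using (zero; suc; _+_; _*_; _<_; _≟_; _<?_; z≤n; s≤s)
open import Data.Nat.DivMod using (_mod_; m<n⇒m%n≡m)
open import Data.Nat.Properties
  using ( ≤-refl; ≤-reflexive; ≤-trans; ≤-antisym; <-irrefl; ≮⇒≥; ≰⇒>; n≤1+n; m<1+n⇒m<n∨m≡n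
        ; suc-injective; +-assoc; +-comm; +-cancelʳ-≡; +-cancelʳ-<; +-mono-<-≤; m+n≮n )
open import Data.List.Membership.DecPropositional _≟_ using (_∈?_)
open import Data.Product using (Σ; _,_; proj₁; proj₂)
open import Data.Sum using (_⊎_; inj₁; inj₂; [_,_]′)
open import Function using (_∘_)
open import Relation.Nullary using (¬_; Dec; yes; no)
open import Relation.Nullary.Decidable
  using (recompute; map′; ¬?; _→-dec_; _×-dec_; _⊎-dec_; True; toWitness)
open import Relation.Binary.PropositionalEquality

Unique⇒lookup-injective : ∀ {xs : List ℕ} → Unique xs → ∀ i j → lookup xs i ≡ lookup xs j → i ≡ j
Unique⇒lookup-injective (_ ∷ _) Fin.zero Fin.zero _ = refl
Unique⇒lookup-injective (x∉ ∷ _) Fin.zero (Fin.suc j) eq = ⊥-elim (All.lookup x∉ (∈-lookup j) eq)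
Unique⇒lookup-injective (x∉ ∷ _) (Fin.suc i) Fin.zero eq = ⊥-elim (All.lookup x∉ (∈-lookup i) (sym eq))
Unique⇒lookup-injective (_ ∷ u) (Fin.suc i) (Fin.suc j) eq = cong Fin.suc (Unique⇒lookup-injective u i j eq)

Unique⇒⊈-shorter : ∀ {xs ys : List ℕ} → Unique xs → length ys < length xs → ¬ (xs ⊆ ys)
Unique⇒⊈-shorter {xs} {ys} u ys<xs xs⊆ys =
  let i , j , i<j , same = pigeonhole ys<xs position in
  <-irrefl (cong toℕ (Unique⇒lookup-injective u i j (same-position⇒same-entry same))) i<j
  where
  open ≡-Reasoning
  position : Fin (length xs) → Fin (length ys)
  position i = Any.index (xs⊆ys (∈-lookup i))
  same-position⇒same-entry : ∀ {i j} → position i ≡ position j → lookup xs i ≡ lookup xs j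
  same-position⇒same-entry {i} {j} same = begin
    lookup xs i             ≡⟨ lookup-index (xs⊆ys (∈-lookup i)) ⟩
    lookup ys (position i)  ≡⟨ cong (lookup ys) same ⟩
    lookup ys (position j)  ≡⟨ lookup-index (xs⊆ys (∈-lookup j)) ⟨
    lookup xs j             ∎

fresh : ∀ {xs : List ℕ} → Unique xs → (ys : List ℕ) → length ys < length xs →
        ∃ λ x → x ∈ xs × x ∉ ys
fresh {xs} u ys ys<xs =
  let i , xsᵢ∉ys = ¬∀⟶∃¬ _ _ (λ i → lookup xs i ∈? ys) all-in in
  lookup xs i , ∈-lookup i , xsᵢ∉ys
  where
  all-in : ¬ (∀ i → lookup xs i ∈ ys)
  all-in h = Unique⇒⊈-shorter u ys<xs λ x∈xs →
    subst (_∈ ys) (sym (lookup-index x∈xs)) (h (Any.index x∈xs))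

Least : (ℕ → Set) → ℕ → Set
Least P k = P k × (∀ r → r < k → ¬ P r)

least-or-none-below : {P : ℕ → Set} → (∀ r → Dec (P r)) → ∀ N →
                      (∃ (Least P)) ⊎ (∀ r → r < N → ¬ P r)
least-or-none-below P? zero = inj₂ λ _ ()
least-or-none-below {P} P? (suc N) with least-or-none-below P? N
... | inj₁ least = inj₁ least
... | inj₂ none-below with P? N
...   | yes P[N] = inj₁ (N , P[N] , none-below)
...   | no ¬P[N] = inj₂ λ r r<1+N → none-up-to r (m<1+n⇒m<n∨m≡n r<1+N)
  where
  none-up-to : ∀ r → r < N ⊎ r ≡ N → ¬ P r
  none-up-to r (inj₁ r<N) = none-below r r<N
  none-up-to r (inj₂ refl) = ¬P[N]

least-satisfying : {P : ℕ → Set} → (∀ r → Dec (P r)) → ∀ {N} → P N → ∃ (Least P)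
least-satisfying P? {N} P[N] with least-or-none-below P? (suc N)
... | inj₁ least = least
... | inj₂ none = ⊥-elim (none N ≤-refl P[N])

Least-transfer : {P Q : ℕ → Set} {m k : ℕ} → (∀ r → Q r → P r) → (∀ r → m ≤ r → P r → Q r) →
                 m ≤ k → Least P k → Least Q k
Least-transfer Q⇒P P⇒Q m≤k (P[k] , minimal) =
  P⇒Q _ m≤k P[k] , λ r r<k Q[r] → minimal r r<k (Q⇒P r Q[r])

Least-lower-bound : {P : ℕ → Set} {m k : ℕ} → (∀ {r s} → r ≤ s → P r → P s) → ¬ P m →
                    Least P k → suc m ≤ k
Least-lower-bound P-mono ¬P[m] (P[k] , _) = ≰⇒> λ k≤m → ¬P[m] (P-mono k≤m P[k])

ListColouring : (V : Set) → (V → V → Set) → (V → List ℕ) → Set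
ListColouring V Adj L = Σ (V → ℕ) λ c → (∀ v → c v ∈ L v) × (∀ u v → Adj u v → c u ≢ c v)

ListColourable-mono : ∀ {V : Set} {Adj : V → V → Set} {r s} → r ≤ s →
                      ListColourable V Adj r → ListColourable V Adj s
ListColourable-mono r≤s colourable L (unique , long) = colourable L (unique , λ v → ≤-trans r≤s (long v))

ListColourable-subgraph : ∀ {V : Set} {Adj Adj′ : V → V → Set} {r} → (∀ u v → Adj u v → Adj′ u v) →
                          ListColourable V Adj′ r → ListColourable V Adj r
ListColourable-subgraph Adj⇒Adj′ colourable L assignment =
  let c , c∈L , proper = colourable L assignment in
  c , c∈L , λ u v adj → proper u v (Adj⇒Adj′ u v adj)

complete-ListColourable : ∀ n → ListColourable (Fin n) _≢_ n
complete-ListColourable zero L _ = (λ ()) , (λ ()) , (λ ())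
complete-ListColourable (suc n) L (unique , long) = c , c∈L , proper
  where
  rest : ListColouring (Fin n) _≢_ (L ∘ Fin.suc)
  rest = complete-ListColourable n (L ∘ Fin.suc)
           (unique ∘ Fin.suc , λ v → ≤-trans (n≤1+n n) (long (Fin.suc v)))
  c′ : Fin n → ℕ
  c′ = proj₁ rest
  new : ∃ λ x → x ∈ L Fin.zero × x ∉ tabulate c′
  new = fresh (unique Fin.zero) (tabulate c′)
          (subst (_< length (L Fin.zero)) (sym (length-tabulate c′)) (long Fin.zero))
  new∉c′ : ∀ v → proj₁ new ≢ c′ v
  new∉c′ v eq = proj₂ (proj₂ new) (subst (_∈ tabulate c′) (sym eq) (∈-tabulate⁺ v))
  c : Fin (suc n) → ℕ
  c Fin.zero = proj₁ new
  c (Fin.suc v) = c′ v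
  c∈L : ∀ v → c v ∈ L v
  c∈L Fin.zero = proj₁ (proj₂ new)
  c∈L (Fin.suc v) = proj₁ (proj₂ rest) v
  proper : ∀ u v → u ≢ v → c u ≢ c v
  proper Fin.zero Fin.zero 0≢0 = ⊥-elim (0≢0 refl)
  proper Fin.zero (Fin.suc v) _ = new∉c′ v
  proper (Fin.suc u) Fin.zero _ = new∉c′ u ∘ sym
  proper (Fin.suc u) (Fin.suc v) u≢v = proj₂ (proj₂ rest) u v (u≢v ∘ cong Fin.suc)

module _ {m k : ℕ} {P : (Fin m → Fin k) → Set} (P-resp : ∀ {f g} → f ≗ g → P f → P g)
         (P? : ∀ f → Dec (P f)) where

  all-functions? : Dec (∀ f → P f)
  all-functions? = map′ (λ all f → P-resp (finToFun-funToFin f) (all (funToFin f)))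
                        (λ all code → all (finToFun code))
                        (all? (P? ∘ finToFun))

  any-function? : Dec (∃ P)
  any-function? = map′ (λ (code , p) → finToFun code , p)
                       (λ (f , p) → funToFin f , P-resp (sym ∘ finToFun-funToFin f) p)
                       (any? (P? ∘ finToFun))

module _ {m : ℕ} (f : Fin m → ℕ) where

  private
    preimage : (x : ℕ) → .(∃ λ j → f j ≡ x) → ∃ λ j → f j ≡ x
    preimage x = recompute (any? λ j → f j ≟ x)

  -- The witness is recomputed from an irrelevant proof, so it depends on k only through f k.
  representative : Fin m → Fin m
  representative k = proj₁ (preimage (f k) (k , refl))

  f∘representative : ∀ k → f (representative k) ≡ f k
  f∘representative k = proj₂ (preimage (f k) (k , refl))

  representative-cong : ∀ {k l} → f k ≡ f l → representative k ≡ representative l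
  representative-cong = preimage-cong
    where
    preimage-cong : ∀ {x y} .{p q} → x ≡ y → proj₁ (preimage x p) ≡ proj₁ (preimage y q)
    preimage-cong refl = refl

-- A table stands for an r-list assignment up to renaming of colours: it sends the slot of entry i
-- of the list of u to a code in Fin (n * r), equal codes meaning equal colours.
module _ {n : ℕ} (Adj : Fin n → Fin n → Set) (Adj? : ∀ u v → Dec (Adj u v)) where

  module _ (r : ℕ) where

    slot : Fin n → Fin r → Fin (n * r)
    slot = combine

    Table : Set
    Table = Fin (n * r) → Fin (n * r)

    RowInjective : Table → Set
    RowInjective T = ∀ u i j → T (slot u i) ≡ T (slot u j) → i ≡ j

    ProperFor : Table → (Fin n → Fin r) → Set
    ProperFor T σ = ∀ u v → Adj u v → T (slot u (σ u)) ≢ T (slot v (σ v))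

    TableColourable : Set
    TableColourable = (T : Table) → RowInjective T → ∃ (ProperFor T)

    TableColourable? : Dec TableColourable
    TableColourable? =
      all-functions? resp-T λ T → RowInjective? T →-dec any-function? (resp-σ T) (ProperFor? T)
      where
      RowInjective? : (T : Table) → Dec (RowInjective T)
      RowInjective? T = all? λ u → all? λ i → all? λ j → (T (slot u i) Fin.≟ T (slot u j)) →-dec (i Fin.≟ j)
      ProperFor? : (T : Table) → ∀ σ → Dec (ProperFor T σ)
      ProperFor? T σ = all? λ u → all? λ v → Adj? u v →-dec ¬? (T (slot u (σ u)) Fin.≟ T (slot v (σ v)))
      resp-σ : (T : Table) → ∀ {σ τ} → σ ≗ τ → ProperFor T σ → ProperFor T τ
      resp-σ T σ≗τ proper u v adj =
        proper u v adj ∘ subst₂ (λ i j → T (slot u i) ≡ T (slot v j)) (sym (σ≗τ u)) (sym (σ≗τ v))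
      resp-T : ∀ {T T′ : Table} → T ≗ T′ →
               (RowInjective T → ∃ (ProperFor T)) → RowInjective T′ → ∃ (ProperFor T′)
      resp-T {T} {T′} T≗T′ colourable injective′ =
        let σ , proper = colourable λ u i j eq → injective′ u i j (trans (sym (T≗T′ _)) (trans eq (T≗T′ _)))
        in σ , λ u v adj eq → proper u v adj (trans (T≗T′ _) (trans eq (sym (T≗T′ _))))

    ListColourable⇒TableColourable : ListColourable (Fin n) Adj r → TableColourable
    ListColourable⇒TableColourable colourable T injective = σ , proper
      where
      L : Fin n → List ℕ
      L u = tabulate λ i → toℕ (T (slot u i))
      L-assignment : IsListAssignment r L
      L-assignment = (λ u → tabulate⁺ (injective u _ _ ∘ Finₚ.toℕ-injective))
                   , (λ u → ≤-reflexive (sym (length-tabulate _)))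
      colouring : ListColouring (Fin n) Adj L
      colouring = colourable L L-assignment
      c : Fin n → ℕ
      c = proj₁ colouring
      position : ∀ u → ∃ λ i → c u ≡ toℕ (T (slot u i))
      position u = ∈-tabulate⁻ (proj₁ (proj₂ colouring) u)
      σ : Fin n → Fin r
      σ u = proj₁ (position u)
      proper : ProperFor T σ
      proper u v adj eq = proj₂ (proj₂ colouring) u v adj (begin
        c u                      ≡⟨ proj₂ (position u) ⟩
        toℕ (T (slot u (σ u)))   ≡⟨ cong toℕ eq ⟩
        toℕ (T (slot v (σ v)))   ≡⟨ proj₂ (position v) ⟨
        c v                      ∎)
        where open ≡-Reasoning

    TableColourable⇒ListColourable : TableColourable → ListColourable (Fin n) Adj r
    TableColourable⇒ListColourable colourable L (unique , long) = c , c∈L , proper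
      where
      entry : Fin n → Fin r → ℕ
      entry u i = lookup (L u) (inject≤ i (long u))
      colour : Fin (n * r) → ℕ
      colour k = let u , i = remQuot r k in entry u i
      colour-slot : ∀ u i → colour (slot u i) ≡ entry u i
      colour-slot u i = cong (λ (u , i) → entry u i) (Finₚ.remQuot-combine {n} {r} u i)
      T : Table
      T = representative colour
      same-code⇒same-entry : ∀ u v i j → T (slot u i) ≡ T (slot v j) → entry u i ≡ entry v j
      same-code⇒same-entry u v i j eq = begin
        entry u i              ≡⟨ colour-slot u i ⟨
        colour (slot u i)      ≡⟨ f∘representative colour (slot u i) ⟨
        colour (T (slot u i))  ≡⟨ cong colour eq ⟩
        colour (T (slot v j))  ≡⟨ f∘representative colour (slot v j) ⟩
        colour (slot v j)      ≡⟨ colour-slot v j ⟩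
        entry v j              ∎
        where open ≡-Reasoning
      injective : RowInjective T
      injective u i j eq = Finₚ.inject≤-injective _ _ i j
        (Unique⇒lookup-injective (unique u) _ _ (same-code⇒same-entry u u i j eq))
      choice : ∃ (ProperFor T)
      choice = colourable T injective
      σ : Fin n → Fin r
      σ = proj₁ choice
      c : Fin n → ℕ
      c u = entry u (σ u)
      c∈L : ∀ u → c u ∈ L u
      c∈L u = ∈-lookup _
      proper : ∀ u v → Adj u v → c u ≢ c v
      proper u v adj eq = proj₂ choice u v adj (representative-cong colour (begin
        colour (slot u (σ u))  ≡⟨ colour-slot u (σ u) ⟩
        c u                    ≡⟨ eq ⟩
        c v                    ≡⟨ colour-slot v (σ v) ⟨
        colour (slot v (σ v))  ∎))
        where open ≡-Reasoning

  ListColourable? : ∀ r → Dec (ListColourable (Fin n) Adj r)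
  ListColourable? r =
    map′ (TableColourable⇒ListColourable r) (ListColourable⇒TableColourable r) (TableColourable? r)

+-right-comm : ∀ x y z → x + y + z ≡ x + z + y
+-right-comm x y z = trans (+-assoc x y z) (trans (cong (x +_) (+-comm y z)) (sym (+-assoc x z y)))

toℕ≢m+n : ∀ {n} (a : Fin n) m → toℕ a ≢ m + n
toℕ≢m+n {n} a m eq = m+n≮n m n (subst (_< n) eq (Finₚ.toℕ<n a))

module _ {n : ℕ} where
  open ≡-Reasoning

  Fwd-functional : ∀ {k} {x a b : Fin n} → Fwd k x a → Fwd k x b → a ≡ b
  Fwd-functional (inj₁ a≡) (inj₁ b≡) = Finₚ.toℕ-injective (trans a≡ (sym b≡))
  Fwd-functional {a = a} (inj₁ a≡) (inj₂ b+n≡) = ⊥-elim (toℕ≢m+n a _ (trans a≡ (sym b+n≡)))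
  Fwd-functional {b = b} (inj₂ a+n≡) (inj₁ b≡) = ⊥-elim (toℕ≢m+n b _ (trans b≡ (sym a+n≡)))
  Fwd-functional (inj₂ a+n≡) (inj₂ b+n≡) = Finₚ.toℕ-injective (+-cancelʳ-≡ n _ _ (trans a+n≡ (sym b+n≡)))

  Fwd-injective : ∀ {k} {a b x : Fin n} → Fwd k a x → Fwd k b x → a ≡ b
  Fwd-injective {k} (inj₁ x≡a+k) (inj₁ x≡b+k) =
    Finₚ.toℕ-injective (+-cancelʳ-≡ k _ _ (trans (sym x≡a+k) x≡b+k))
  Fwd-injective {k} {a} {b} {x} (inj₁ x≡a+k) (inj₂ x+n≡b+k) =
    ⊥-elim (toℕ≢m+n b (toℕ a) (+-cancelʳ-≡ k _ _ (begin
    toℕ b + k            ≡⟨ x+n≡b+k ⟨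
    toℕ x + n            ≡⟨ cong (_+ n) x≡a+k ⟩
    toℕ a + k + n        ≡⟨ +-right-comm (toℕ a) k n ⟩
    toℕ a + n + k        ∎)))
  Fwd-injective {k} {a} {b} {x} (inj₂ x+n≡a+k) (inj₁ x≡b+k) =
    ⊥-elim (toℕ≢m+n a (toℕ b) (+-cancelʳ-≡ k _ _ (begin
    toℕ a + k            ≡⟨ x+n≡a+k ⟨
    toℕ x + n            ≡⟨ cong (_+ n) x≡b+k ⟩
    toℕ b + k + n        ≡⟨ +-right-comm (toℕ b) k n ⟩
    toℕ b + n + k        ∎)))
  Fwd-injective {k} (inj₂ x+n≡a+k) (inj₂ x+n≡b+k) =
    Finₚ.toℕ-injective (+-cancelʳ-≡ k _ _ (trans (sym x+n≡a+k) x+n≡b+k))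

  Fwd-trans : ∀ {j k} {a x b : Fin n} → j + k ≤ n → Fwd j a x → Fwd k x b → Fwd (j + k) a b
  Fwd-trans {j} {k} {a} _ (inj₁ x≡a+j) (inj₁ b≡x+k) = inj₁ (begin
    _                    ≡⟨ b≡x+k ⟩
    _ + k                ≡⟨ cong (_+ k) x≡a+j ⟩
    toℕ a + j + k        ≡⟨ +-assoc (toℕ a) j k ⟩
    toℕ a + (j + k)      ∎)
  Fwd-trans {j} {k} {a} _ (inj₁ x≡a+j) (inj₂ b+n≡x+k) = inj₂ (begin
    _                    ≡⟨ b+n≡x+k ⟩
    _ + k                ≡⟨ cong (_+ k) x≡a+j ⟩
    toℕ a + j + k        ≡⟨ +-assoc (toℕ a) j k ⟩
    toℕ a + (j + k)      ∎)
  Fwd-trans {j} {k} {a} {x} _ (inj₂ x+n≡a+j) (inj₁ b≡x+k) = inj₂ (begin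
    _ + n                ≡⟨ cong (_+ n) b≡x+k ⟩
    toℕ x + k + n        ≡⟨ +-right-comm (toℕ x) k n ⟩
    toℕ x + n + k        ≡⟨ cong (_+ k) x+n≡a+j ⟩
    toℕ a + j + k        ≡⟨ +-assoc (toℕ a) j k ⟩
    toℕ a + (j + k)      ∎)
  Fwd-trans {j} {k} {a} {x} {b} j+k≤n (inj₂ x+n≡a+j) (inj₂ b+n≡x+k) =
    ⊥-elim (m+n≮n (toℕ b) n (+-cancelʳ-< n _ _
      (subst (_< n + n) (sym b+n+n≡a+j+k) (+-mono-<-≤ (Finₚ.toℕ<n a) j+k≤n))))
    where
    b+n+n≡a+j+k : toℕ b + n + n ≡ toℕ a + (j + k)
    b+n+n≡a+j+k = begin
      toℕ b + n + n      ≡⟨ cong (_+ n) b+n≡x+k ⟩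
      toℕ x + k + n      ≡⟨ +-right-comm (toℕ x) k n ⟩
      toℕ x + n + k      ≡⟨ cong (_+ k) x+n≡a+j ⟩
      toℕ a + j + k      ≡⟨ +-assoc (toℕ a) j k ⟩
      toℕ a + (j + k)    ∎

  Fwd-cancel : ∀ {j k} {u x v : Fin n} → Fwd j u x → Fwd (j + k) u v → Fwd k x v
  Fwd-cancel {j} {k} {u} (inj₁ x≡u+j) (inj₁ v≡u+j+k) = inj₁ (begin
    _                    ≡⟨ v≡u+j+k ⟩
    toℕ u + (j + k)      ≡⟨ +-assoc (toℕ u) j k ⟨
    toℕ u + j + k        ≡⟨ cong (_+ k) x≡u+j ⟨
    _ + k                ∎)
  Fwd-cancel {j} {k} {u} (inj₁ x≡u+j) (inj₂ v+n≡u+j+k) = inj₂ (begin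
    _                    ≡⟨ v+n≡u+j+k ⟩
    toℕ u + (j + k)      ≡⟨ +-assoc (toℕ u) j k ⟨
    toℕ u + j + k        ≡⟨ cong (_+ k) x≡u+j ⟨
    _ + k                ∎)
  Fwd-cancel {j} {k} {u} {x} {v} (inj₂ x+n≡u+j) (inj₁ v≡u+j+k) = ⊥-elim (toℕ≢m+n v (toℕ x + k) (begin
    toℕ v                ≡⟨ v≡u+j+k ⟩
    toℕ u + (j + k)      ≡⟨ +-assoc (toℕ u) j k ⟨
    toℕ u + j + k        ≡⟨ cong (_+ k) x+n≡u+j ⟨
    toℕ x + n + k        ≡⟨ +-right-comm (toℕ x) n k ⟩
    toℕ x + k + n        ∎))
  Fwd-cancel {j} {k} {u} {x} {v} (inj₂ x+n≡u+j) (inj₂ v+n≡u+j+k) = inj₁ (+-cancelʳ-≡ n _ _ (begin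
    toℕ v + n            ≡⟨ v+n≡u+j+k ⟩
    toℕ u + (j + k)      ≡⟨ +-assoc (toℕ u) j k ⟨
    toℕ u + j + k        ≡⟨ cong (_+ k) x+n≡u+j ⟨
    toℕ x + n + k        ≡⟨ +-right-comm (toℕ x) n k ⟩
    toℕ x + k + n        ∎))

Fwd-successor : ∀ {n} (u : Fin n) → ∃ (Fwd 1 u)
Fwd-successor {suc n} u with suc (toℕ u) <? suc n
... | yes u+1<1+n = fromℕ< u+1<1+n , inj₁ (trans (Finₚ.toℕ-fromℕ< u+1<1+n) (+-comm 1 (toℕ u)))
... | no u+1≮1+n = Fin.zero , inj₂ (trans (sym (≤-antisym (Finₚ.toℕ<n u) (≮⇒≥ u+1≮1+n))) (+-comm 1 (toℕ u)))

Fwd? : ∀ {n} k (i j : Fin n) → Dec (Fwd k i j)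
Fwd? {n} k i j = (toℕ j ≟ toℕ i + k) ⊎-dec (toℕ j + n ≟ toℕ i + k)

CycleAdj? : ∀ {n} (i j : Fin n) → Dec (CycleAdj i j)
CycleAdj? i j = Fwd? 1 i j ⊎-dec Fwd? 1 j i

CycleSqAdj? : ∀ {n} (i j : Fin n) → Dec (CycleSqAdj i j)
CycleSqAdj? i j = CycleAdj? i j ⊎-dec (Fwd? 2 i j ⊎-dec Fwd? 2 j i)

CoCycleSqAdj? : ∀ {n} (i j : Fin n) → Dec (CoCycleSqAdj i j)
CoCycleSqAdj? i j = ¬? (i Fin.≟ j) ×-dec ¬? (CycleSqAdj? i j)

module Chain (L : ℕ → List ℕ) (unique : ∀ m → Unique (L m)) (long : ∀ m → 3 ≤ length (L m)) where

  chain : ℕ → ℕ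
  chain-step : ∀ m → ∃ λ x → x ∈ L (suc m) × x ∉ chain m ∷ chain 0 ∷ []

  chain zero = lookup (L 0) (fromℕ< (≤-trans (s≤s z≤n) (long 0)))
  chain (suc m) = proj₁ (chain-step m)

  chain-step m = fresh (unique (suc m)) (chain m ∷ chain 0 ∷ []) (long (suc m))

  chain-∈ : ∀ m → chain m ∈ L m
  chain-∈ zero = ∈-lookup _
  chain-∈ (suc m) = proj₁ (proj₂ (chain-step m))

  chain-≢-previous : ∀ m → chain (suc m) ≢ chain m
  chain-≢-previous m eq = proj₂ (proj₂ (chain-step m)) (here eq)

  chain-≢-first : ∀ m → chain (suc m) ≢ chain 0
  chain-≢-first m eq = proj₂ (proj₂ (chain-step m)) (there (here eq))

wrap-around : ∀ {n} (u : Fin n) v → v + n ≡ toℕ u + 1 → v ≡ 0 × suc (toℕ u) ≡ n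
wrap-around u zero n≡u+1 = refl , trans (+-comm 1 (toℕ u)) (sym n≡u+1)
wrap-around {n} u (suc v) 1+v+n≡u+1 =
  ⊥-elim (toℕ≢m+n u v (+-cancelʳ-≡ 1 _ _ (trans (sym 1+v+n≡u+1) (+-comm 1 (v + n)))))

cycle-colouring : ∀ {n} → 2 ≤ n → (L : Fin n → List ℕ) → IsListAssignment 3 L →
                  ListColouring (Fin n) (Fwd 1) L
cycle-colouring {n@(suc (suc n-2))} (s≤s (s≤s z≤n)) L (unique , long) = c , c∈L , proper
  where
  open Chain (λ m → L (m mod n)) (λ m → unique (m mod n)) (λ m → long (m mod n))
  mod-toℕ : ∀ v → toℕ v mod n ≡ v
  mod-toℕ v = Finₚ.toℕ-injective (trans (Finₚ.toℕ-fromℕ< _) (m<n⇒m%n≡m (Finₚ.toℕ<n v)))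
  c : Fin n → ℕ
  c v = chain (toℕ v)
  c∈L : ∀ v → c v ∈ L v
  c∈L v = subst (λ w → c v ∈ L w) (mod-toℕ v) (chain-∈ (toℕ v))
  proper : ∀ u v → Fwd 1 u v → c u ≢ c v
  proper u v (inj₁ v≡u+1) cu≡cv =
    chain-≢-previous (toℕ u) (trans (cong chain (trans (+-comm 1 (toℕ u)) (sym v≡u+1))) (sym cu≡cv))
  proper u v (inj₂ v+n≡u+1) cu≡cv with wrap-around u (toℕ v) v+n≡u+1
  ... | v≡0 , 1+u≡n = chain-≢-first n-2 (begin
    chain (suc n-2)    ≡⟨ cong chain (suc-injective 1+u≡n) ⟨
    c u                ≡⟨ cu≡cv ⟩
    c v                ≡⟨ cong chain v≡0 ⟩
    chain 0            ∎)
    where open ≡-Reasoning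

module _ (G : EGraph) where
  open EGraph G

  RainbowGeodesic : (E → ℕ) → V → V → Set
  RainbowGeodesic c u v = ∃ λ k → Σ (Walk G u v k) λ w → IsGeodesic G w × IsRainbow G c w

  trivial-walk : ∀ u → Walk G u u 0
  trivial-walk u = record { verts = λ _ → u ; edges = λ () ; start = refl ; end = refl ; step = λ () }

  edge-walk : ∀ {e u v} → Joins e u v → Walk G u v 1
  edge-walk {e} {u} {v} u-v =
    record { verts = verts ; edges = λ _ → e ; start = refl ; end = refl ; step = step }
    where
    verts : Fin 2 → V
    verts Fin.zero = u
    verts (Fin.suc _) = v
    step : ∀ i → Joins e (verts (inject₁ i)) (verts (Fin.suc i))
    step Fin.zero = u-v

  two-edge-walk : ∀ {e f u x v} → Joins e u x → Joins f x v → Walk G u v 2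
  two-edge-walk {e} {f} {u} {x} {v} u-x x-v =
    record { verts = verts ; edges = edges ; start = refl ; end = refl ; step = step }
    where
    verts : Fin 3 → V
    verts Fin.zero = u
    verts (Fin.suc Fin.zero) = x
    verts (Fin.suc (Fin.suc _)) = v
    edges : Fin 2 → E
    edges Fin.zero = e
    edges (Fin.suc _) = f
    step : ∀ i → Joins (edges i) (verts (inject₁ i)) (verts (Fin.suc i))
    step Fin.zero = u-x
    step (Fin.suc Fin.zero) = x-v

  walk₀-endpoints : ∀ {u v} → Walk G u v 0 → u ≡ v
  walk₀-endpoints w = trans (sym (Walk.start w)) (Walk.end w)

  geodesic-if-no-shorter : ∀ {u v k} → (∀ k′ → k′ < k → ¬ Walk G u v k′) →
                           (w : Walk G u v k) → IsGeodesic G w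
  geodesic-if-no-shorter none-shorter w k′ w′ = ≮⇒≥ λ k′<k → none-shorter k′ k′<k w′

  trivial-rainbow : ∀ {u} c (w : Walk G u u 0) → IsRainbow G c w
  trivial-rainbow c w ()

  edge-rainbow : ∀ {u v} c (w : Walk G u v 1) → IsRainbow G c w
  edge-rainbow c w Fin.zero Fin.zero _ = refl

  two-edge-rainbow : ∀ {u v} c (w : Walk G u v 2) →
                     c (Walk.edges w Fin.zero) ≢ c (Walk.edges w (Fin.suc Fin.zero)) → IsRainbow G c w
  two-edge-rainbow c w _ Fin.zero Fin.zero _ = refl
  two-edge-rainbow c w c₀≢c₁ Fin.zero (Fin.suc Fin.zero) c₀≡c₁ = ⊥-elim (c₀≢c₁ c₀≡c₁)
  two-edge-rainbow c w c₀≢c₁ (Fin.suc Fin.zero) Fin.zero c₁≡c₀ = ⊥-elim (c₀≢c₁ (sym c₁≡c₀))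
  two-edge-rainbow c w _ (Fin.suc Fin.zero) (Fin.suc Fin.zero) _ = refl

  trivial-rainbow-geodesic : ∀ c u → RainbowGeodesic c u u
  trivial-rainbow-geodesic c u = 0 , trivial-walk u , (λ _ _ → z≤n) , trivial-rainbow c (trivial-walk u)

  edge-rainbow-geodesic : ∀ c {e u v} → u ≢ v → Joins e u v → RainbowGeodesic c u v
  edge-rainbow-geodesic c {u = u} {v = v} u≢v u-v =
    1 , edge-walk u-v , geodesic-if-no-shorter no-shorter (edge-walk u-v) , edge-rainbow c (edge-walk u-v)
    where
    no-shorter : ∀ k → k < 1 → ¬ Walk G u v k
    no-shorter zero _ w₀ = u≢v (walk₀-endpoints w₀)
    no-shorter (suc _) (s≤s ()) _

module _ {n : ℕ} where

  rim-injective : ∀ {a b : Fin n} → rim a ≡ rim b → a ≡ b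
  rim-injective refl = refl

  rim-edge⇒CycleAdj : ∀ {a b : Fin n} {e} → WJoins n e (rim a) (rim b) → CycleAdj a b
  rim-edge⇒CycleAdj (rim-fwd _ _ a→b) = inj₁ a→b
  rim-edge⇒CycleAdj (rim-bwd _ _ b→a) = inj₂ b→a

  rim-walk₁⇒CycleAdj : ∀ {a b : Fin n} → Walk (Wheel n) (rim a) (rim b) 1 → CycleAdj a b
  rim-walk₁⇒CycleAdj w = rim-edge⇒CycleAdj
    (subst₂ (WJoins n (Walk.edges w Fin.zero)) (Walk.start w) (Walk.end w) (Walk.step w Fin.zero))

  rim-no-walk-shorter-than-2 : ∀ {a b : Fin n} → a ≢ b → ¬ CycleAdj a b →
                               ∀ k → k < 2 → ¬ Walk (Wheel n) (rim a) (rim b) k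
  rim-no-walk-shorter-than-2 a≢b _ zero _ w = a≢b (rim-injective (walk₀-endpoints (Wheel n) w))
  rim-no-walk-shorter-than-2 _ ¬adj (suc zero) _ w = ¬adj (rim-walk₁⇒CycleAdj w)
  rim-no-walk-shorter-than-2 _ _ (suc (suc _)) (s≤s (s≤s ())) _

  far-rims-two-step⇒spokes : ∀ {a b : Fin n} {e f x} → 2 ≤ n → a ≢ b → ¬ CycleSqAdj a b →
    WJoins n e (rim a) x → WJoins n f x (rim b) → e ≡ spoke a × f ≡ spoke b
  far-rims-two-step⇒spokes _ _ _ (spoke-in _) (spoke-out _) = refl , refl
  far-rims-two-step⇒spokes 2≤n _ ¬sq (rim-fwd _ _ a→x) (rim-fwd _ _ x→b) =
    ⊥-elim (¬sq (inj₂ (inj₁ (Fwd-trans {j = 1} {k = 1} 2≤n a→x x→b))))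
  far-rims-two-step⇒spokes _ a≢b _ (rim-fwd _ _ a→x) (rim-bwd _ _ b→x) =
    ⊥-elim (a≢b (Fwd-injective {k = 1} a→x b→x))
  far-rims-two-step⇒spokes _ a≢b _ (rim-bwd _ _ x→a) (rim-fwd _ _ x→b) =
    ⊥-elim (a≢b (Fwd-functional {k = 1} x→a x→b))
  far-rims-two-step⇒spokes 2≤n _ ¬sq (rim-bwd _ _ x→a) (rim-bwd _ _ b→x) =
    ⊥-elim (¬sq (inj₂ (inj₂ (Fwd-trans {j = 1} {k = 1} 2≤n b→x x→a))))

  far-rims-walk₂⇒spokes : ∀ {a b : Fin n} → 2 ≤ n → a ≢ b → ¬ CycleSqAdj a b →
                          (w : Walk (Wheel n) (rim a) (rim b) 2) →
                          Walk.edges w Fin.zero ≡ spoke a × Walk.edges w (Fin.suc Fin.zero) ≡ spoke b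
  far-rims-walk₂⇒spokes 2≤n a≢b ¬sq w = far-rims-two-step⇒spokes 2≤n a≢b ¬sq
    (subst (λ u → WJoins n e₀ u middle) (Walk.start w) (Walk.step w Fin.zero))
    (subst (WJoins n e₁ middle) (Walk.end w) (Walk.step w (Fin.suc Fin.zero)))
    where
    open Walk w
    e₀ e₁ : WEdge n
    e₀ = edges Fin.zero
    e₁ = edges (Fin.suc Fin.zero)
    middle : WVertex n
    middle = verts (Fin.suc Fin.zero)

  via-hub : ∀ (a b : Fin n) → Walk (Wheel n) (rim a) (rim b) 2
  via-hub a b = two-edge-walk (Wheel n) (spoke-in a) (spoke-out b)

  rainbow-geodesic⇒spoke-colours-differ : 2 ≤ n → ∀ c {a b : Fin n} → CoCycleSqAdj a b →
    RainbowGeodesic (Wheel n) c (rim a) (rim b) → c (spoke a) ≢ c (spoke b)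
  rainbow-geodesic⇒spoke-colours-differ 2≤n c (a≢b , ¬sq) (2 , w , _ , rainbow) ca≡cb
    with far-rims-walk₂⇒spokes 2≤n a≢b ¬sq w
  ... | e₀≡spoke-a , e₁≡spoke-b = Finₚ.0≢1+n (rainbow Fin.zero (Fin.suc Fin.zero)
        (trans (cong c e₀≡spoke-a) (trans ca≡cb (cong c (sym e₁≡spoke-b)))))
  rainbow-geodesic⇒spoke-colours-differ _ c (a≢b , ¬sq) (0 , w , _) =
    ⊥-elim (rim-no-walk-shorter-than-2 a≢b (¬sq ∘ inj₁) 0 (s≤s z≤n) w)
  rainbow-geodesic⇒spoke-colours-differ _ c (a≢b , ¬sq) (1 , w , _) =
    ⊥-elim (rim-no-walk-shorter-than-2 a≢b (¬sq ∘ inj₁) 1 ≤-refl w)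
  rainbow-geodesic⇒spoke-colours-differ _ c {a} {b} _ (suc (suc (suc _)) , w , geodesic , _)
    with geodesic 2 (via-hub a b)
  ... | s≤s (s≤s ())

SRCListColourable⇒ListColourable : ∀ {n} → 2 ≤ n → ∀ r →
  SRCListColourable (Wheel n) r → ListColourable (Fin n) CoCycleSqAdj r
SRCListColourable⇒ListColourable {n} 2≤n r colourable L (unique , long) =
  let c , c∈L′ , connected = colourable L′ L′-assignment in
  c ∘ spoke , c∈L′ ∘ spoke ,
  λ a b adj → rainbow-geodesic⇒spoke-colours-differ 2≤n c adj (connected (rim a) (rim b))
  where
  L′ : WEdge n → List ℕ
  L′ (spoke i) = L i
  L′ (rimEdge i) = L i
  L′-assignment : IsEdgeListAssignment (Wheel n) r L′
  L′-assignment = (λ { (spoke i) → unique i ; (rimEdge i) → unique i })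
                , (λ { (spoke i) → long i ; (rimEdge i) → long i })

ListColourable⇒SRCListColourable : ∀ {n} → 2 ≤ n → ∀ r → 3 ≤ r →
  ListColourable (Fin n) CoCycleSqAdj r → SRCListColourable (Wheel n) r
ListColourable⇒SRCListColourable {n} 2≤n r 3≤r colourable L (unique , long) = c , c∈L , connected
  where
  spokes : ListColouring (Fin n) CoCycleSqAdj (L ∘ spoke)
  spokes = colourable (L ∘ spoke) (unique ∘ spoke , long ∘ spoke)
  rims : ListColouring (Fin n) (Fwd 1) (L ∘ rimEdge)
  rims = cycle-colouring 2≤n (L ∘ rimEdge) (unique ∘ rimEdge , λ v → ≤-trans 3≤r (long (rimEdge v)))
  c : WEdge n → ℕ
  c (spoke i) = proj₁ spokes i
  c (rimEdge i) = proj₁ rims i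
  c∈L : ∀ e → c e ∈ L e
  c∈L (spoke i) = proj₁ (proj₂ spokes) i
  c∈L (rimEdge i) = proj₁ (proj₂ rims) i
  via-two-edges : ∀ {a b} → a ≢ b → ¬ CycleAdj a b → (w : Walk (Wheel n) (rim a) (rim b) 2) →
                  c (Walk.edges w Fin.zero) ≢ c (Walk.edges w (Fin.suc Fin.zero)) →
                  RainbowGeodesic (Wheel n) c (rim a) (rim b)
  via-two-edges a≢b ¬adj w c₀≢c₁ =
    2 , w , geodesic-if-no-shorter (Wheel n) (rim-no-walk-shorter-than-2 a≢b ¬adj) w ,
    two-edge-rainbow (Wheel n) c w c₀≢c₁
  rim-to-rim : ∀ a b → RainbowGeodesic (Wheel n) c (rim a) (rim b)
  rim-to-rim a b with a Fin.≟ b | CycleAdj? a b | Fwd? 2 a b | Fwd? 2 b a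
  ... | yes refl | _ | _ | _ = trivial-rainbow-geodesic (Wheel n) c (rim a)
  ... | no a≢b | yes (inj₁ a→b) | _ | _ =
    edge-rainbow-geodesic (Wheel n) c (a≢b ∘ rim-injective) (rim-fwd a b a→b)
  ... | no a≢b | yes (inj₂ b→a) | _ | _ =
    edge-rainbow-geodesic (Wheel n) c (a≢b ∘ rim-injective) (rim-bwd b a b→a)
  ... | no a≢b | no ¬adj | yes a→→b | _ =
    let x , a→x = Fwd-successor a
        x→b = Fwd-cancel {j = 1} a→x a→→b
    in  via-two-edges a≢b ¬adj (two-edge-walk (Wheel n) (rim-fwd a x a→x) (rim-fwd x b x→b))
                      (proj₂ (proj₂ rims) a x a→x)
  ... | no a≢b | no ¬adj | no _ | yes b→→a =
    let x , b→x = Fwd-successor b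
        x→a = Fwd-cancel {j = 1} b→x b→→a
    in  via-two-edges a≢b ¬adj (two-edge-walk (Wheel n) (rim-bwd x a x→a) (rim-bwd b x b→x))
                      (proj₂ (proj₂ rims) b x b→x ∘ sym)
  ... | no a≢b | no ¬adj | no ¬a→→b | no ¬b→→a =
    via-two-edges a≢b ¬adj (via-hub a b) (proj₂ (proj₂ spokes) a b (a≢b , [ ¬adj , [ ¬a→→b , ¬b→→a ]′ ]′))
  connected : StronglyRainbowConnected (Wheel n) c
  connected hub hub = trivial-rainbow-geodesic (Wheel n) c hub
  connected hub (rim b) = edge-rainbow-geodesic (Wheel n) c (λ ()) (spoke-out b)
  connected (rim a) hub = edge-rainbow-geodesic (Wheel n) c (λ ()) (spoke-in a)
  connected (rim a) (rim b) = rim-to-rim a b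

∈-pair-alternates : ∀ {a b x y z : ℕ} → x ∈ a ∷ b ∷ [] → y ∈ a ∷ b ∷ [] → z ∈ a ∷ b ∷ [] →
                    x ≢ y → y ≢ z → x ≡ z
∈-pair-alternates (here refl) (here refl) _ x≢y _ = ⊥-elim (x≢y refl)
∈-pair-alternates (here refl) (there (here refl)) (here refl) _ _ = refl
∈-pair-alternates (here refl) (there (here refl)) (there (here refl)) _ y≢z = ⊥-elim (y≢z refl)
∈-pair-alternates (there (here refl)) (here refl) (here refl) _ y≢z = ⊥-elim (y≢z refl)
∈-pair-alternates (there (here refl)) (here refl) (there (here refl)) _ _ = refl
∈-pair-alternates (there (here refl)) (there (here refl)) _ x≢y _ = ⊥-elim (x≢y refl)

-- For n ≥ 7 the vertices 0, 3, 6, 2, 5, 1, 4 form a 7-cycle in the complement of C_n², since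
-- consecutive ones are 3 or 4 apart in both directions around C_n.
¬ListColourable-2 : ∀ {n} → 7 ≤ n → ¬ ListColourable (Fin n) CoCycleSqAdj 2
¬ListColourable-2 (s≤s (s≤s (s≤s (s≤s (s≤s (s≤s (s≤s {n = m} z≤n))))))) colourable =
  odd-cycle (colourable (λ _ → 0 ∷ 1 ∷ []) ((λ _ → ((λ ()) All.∷ All.[]) ∷ (All.[] ∷ [])) , (λ _ → ≤-refl)))
  where
  edge : ∀ (i j : Fin (7 + m)) → {True (CoCycleSqAdj? i j)} → CoCycleSqAdj i j
  edge i j {adj} = toWitness adj
  odd-cycle : ¬ ListColouring (Fin (7 + m)) CoCycleSqAdj (λ _ → 0 ∷ 1 ∷ [])
  odd-cycle (c , c∈01 , proper) = proper (# 4) (# 0) (edge _ _) (begin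
    c (# 4)    ≡⟨ via (# 1) ⟩
    c (# 5)    ≡⟨ via (# 2) ⟩
    c (# 6)    ≡⟨ via (# 3) ⟩
    c (# 0)    ∎)
    where
    open ≡-Reasoning
    via : ∀ {i k} j → {True (CoCycleSqAdj? i j)} → {True (CoCycleSqAdj? j k)} → c i ≡ c k
    via {i} {k} j {i-j} {j-k} = ∈-pair-alternates (c∈01 i) (c∈01 j) (c∈01 k)
      (proper i j (toWitness i-j)) (proper j k (toWitness j-k))

proposition3p9 : ∀ (n : ℕ) → 7 ≤ n →
    ∃ λ k → IsSrcList (Wheel n) k × IsListChromaticNumber (Fin n) CoCycleSqAdj k
proposition3p9 n 7≤n =
  let k , χ = least-satisfying (ListColourable? CoCycleSqAdj CoCycleSqAdj?)
                               (ListColourable-subgraph (λ _ _ → proj₁) (complete-ListColourable n))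
      3≤k = Least-lower-bound ListColourable-mono (¬ListColourable-2 7≤n) χ
  in  k , Least-transfer (SRCListColourable⇒ListColourable 2≤n) (ListColourable⇒SRCListColourable 2≤n)
                         3≤k χ
        , χ
  where
  2≤n : 2 ≤ n
  2≤n = ≤-trans (s≤s (s≤s z≤n)) 7≤n
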